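{- A cubic graph semi-covers $F(1,1)$ if and only if it contains a semi-perfect matching. Furthermore, a cubic graph covers $F(1,1)$ if and only if it contains a semi-perfect matching which includes all semi-edges of the graph.
   Context: A graph has finite vertex and edge sets; every edge is a normal edge (two distinct end-vertices, adding 1 to each degree), a loop (one vertex, adding 2 to its degree) or a semi-edge (one vertex, adding 1 to its degree); multiple loops, semi-edges and parallel edges are allowed. Cubic means all degrees equal 3. $F(1,1)$ is the one-vertex graph with one semi-edge and one loop. A covering projection from $G$ to a connected graph $H$ is a pair of surjective maps $f_V:V(G)\to V(H)$, $f_E:E(G)\to E(H)$ with $f_V$ degree preserving, $f_E$ mapping semi-edges onto semi-edges and loops onto loops (normal edges may go to normal edges, loops or semi-edges), $f_E$ incidence preserving, and $f_E$ a local bijection between edge-neighborhoods of each vertex and its image (so the preimage of a loop at $u$ is a disjoint union of cycles spanning $f_V^{ -1}(u)$, the preimage of a semi-edge at $u$ consists of semi-edges and normal edges covering each vertex of $f_V^{ -1}(u)$ exactly once). A semi-covering projection is defined identically except semi-edges may also be mapped onto loops (so the preimage of a loop at $u$ is a disjoint union of cycles and of paths with a semi-edge at each end-vertex, spanning $f_V^{ -1}(u)$). $G$ covers (semi-covers) $H$ if such a projection exists. A semi-perfect matching of $G$ is a set $M\subseteq E(G)$ such that the spanning subgraph $(V(G),M)$ is 1-regular (each vertex incident with exactly one edge of $M$, a semi-edge counting once; loops are thus excluded). -}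

module Defs where

open import Data.Nat using (ℕ; zero; suc; _+_; _*_; _<_)
open import Data.Fin using (Fin; zero; suc; _≟_)
open import Data.Bool using (Bool; true; false)
open import Data.Product using (Σ; _×_; _,_)
open import Relation.Nullary using (¬_; yes; no)
open import Relation.Binary.PropositionalEquality using (_≡_; _≢_)
open import Data.Empty using (⊥)
open import Data.Unit using (⊤)
open import Data.Sum using (_⊎_)

data Ends (n : ℕ) : Set where
  normal : (u v : Fin n) → u ≢ v → Ends n
  loop   : Fin n → Ends n
  semi   : Fin n → Ends n

record Graph : Set where
  field
    nV   : ℕ
    nE   : ℕ
    ends : Fin nE → Ends nV
open Graph public

Vertex : Graph → Set
Vertex G = Fin (nV G)

Edge : Graph → Set
Edge G = Fin (nE G)

sumFin : (m : ℕ) → (Fin m → ℕ) → ℕ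
sumFin zero    f = 0
sumFin (suc m) f = f zero + sumFin m (λ i → f (suc i))

δ : {n : ℕ} → Fin n → Fin n → ℕ
δ u v with u ≟ v
... | yes _ = 1
... | no  _ = 0

incEnds : {n : ℕ} → Ends n → Fin n → ℕ
incEnds (normal u w _) v = δ u v + δ w v
incEnds (loop u)       v = 2 * δ u v
incEnds (semi u)       v = δ u v

inc : (G : Graph) → Edge G → Vertex G → ℕ
inc G e v = incEnds (ends G e) v

deg : (G : Graph) → Vertex G → ℕ
deg G v = sumFin (nE G) (λ e → inc G e v)

Cubic : Graph → Set
Cubic G = (v : Vertex G) → deg G v ≡ 3

IsLoop IsSemi : (G : Graph) → Edge G → Set
IsLoop G e with ends G e
... | loop _ = ⊤
... | _      = ⊥
IsSemi G e with ends G e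
... | semi _ = ⊤
... | _      = ⊥

Surjective : {A B : Set} → (A → B) → Set
Surjective {A} {B} f = (b : B) → Σ A (λ a → f a ≡ b)

-- Conditions shared by covering and semi-covering projections:
-- surjective on vertices and edges, degree preserving, incidence preserving,
-- and a local bijection between the edge-neighbourhoods (counted with
-- multiplicity of edge-ends): for every vertex v of G and every edge e' of H,
-- the number of edge-ends at v of edges mapped to e' equals the number of
-- edge-ends of e' at fV v.
record ProjectionBase (G H : Graph) (fV : Vertex G → Vertex H)
                      (fE : Edge G → Edge H) : Set where
  field
    surjV  : Surjective fV
    surjE  : Surjective fE
    degPres : (v : Vertex G) → deg H (fV v) ≡ deg G v
    incPres : (e : Edge G) (v : Vertex G) → 0 < inc G e v → 0 < inc H (fE e) (fV v)
    localBij : (v : Vertex G) (e' : Edge H) →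
      sumFin (nE G) (λ e → δ (fE e) e' * inc G e v) ≡ inc H e' (fV v)

record CoveringProjection (G H : Graph) : Set where
  field
    fV : Vertex G → Vertex H
    fE : Edge G → Edge H
    base : ProjectionBase G H fV fE
    semi→semi : (e : Edge G) → IsSemi G e → IsSemi H (fE e)
    loop→loop : (e : Edge G) → IsLoop G e → IsLoop H (fE e)

record SemiCoveringProjection (G H : Graph) : Set where
  field
    fV : Vertex G → Vertex H
    fE : Edge G → Edge H
    base : ProjectionBase G H fV fE
    semi→semiOrLoop : (e : Edge G) → IsSemi G e → IsSemi H (fE e) ⊎ IsLoop H (fE e)
    loop→loop : (e : Edge G) → IsLoop G e → IsLoop H (fE e)

Covers SemiCovers : Graph → Graph → Set
Covers G H = CoveringProjection G H
SemiCovers G H = SemiCoveringProjection G H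

F11 : Graph
F11 = record { nV = 1 ; nE = 2 ; ends = e }
  where
  e : Fin 2 → Ends 1
  e zero    = semi zero
  e (suc _) = loop zero

[_∈_] : {G : Graph} → Edge G → (Edge G → Bool) → ℕ
[ e ∈ M ] with M e
... | true  = 1
... | false = 0

IsSemiPerfectMatching : (G : Graph) → (Edge G → Bool) → Set
IsSemiPerfectMatching G M =
  (v : Vertex G) → sumFin (nE G) (λ e → [_∈_] {G} e M * inc G e v) ≡ 1

HasSemiPerfectMatching : Graph → Set
HasSemiPerfectMatching G = Σ (Edge G → Bool) (IsSemiPerfectMatching G)

HasSemiPerfectMatchingWithAllSemiEdges : Graph → Set
HasSemiPerfectMatchingWithAllSemiEdges G =
  Σ (Edge G → Bool) λ M → IsSemiPerfectMatching G M ×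
    ((e : Edge G) → IsSemi G e → M e ≡ true)

{-# OPTIONS --safe #-}
-- A projection of G onto F(1,1) is determined by the set M of edges sent to the
-- semi-edge, and local bijectivity at the semi-edge says exactly that M is a
-- semi-perfect matching.  Conversely, sending M to the semi-edge and all other
-- edges to the loop is locally bijective at the loop as well, because in a cubic
-- graph each vertex has 3 - 1 = 2 darts outside M.  A loop contributes 2 darts to
-- its vertex, so it never lies in M and is sent to the loop; a covering must
-- moreover send semi-edges to the semi-edge, i.e. put them into M.
module Submission where

open import Defs
open import Algebra.Properties.CommutativeSemigroup using (interchange)
open import Data.Bool using (Bool; true; false; if_then_else_)
open import Data.Empty using (⊥-elim)
open import Data.Fin using (Fin; zero; suc; _≟_; fromℕ<)
open import Data.Nat using (ℕ; zero; suc; _+_; _*_; _<_; _≤_; z<s)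
open import Data.Nat.Properties
  using ( +-commutativeSemigroup; ≤-trans; m≤m+n; m≤n+m; *-distribʳ-+; *-identityˡ
        ; suc-injective; n≮0; n≮n; module ≤-Reasoning)
open import Data.Product using (Σ; _×_; _,_; map)
open import Data.Sum using (_⊎_; inj₁; inj₂)
open import Data.Unit using (tt)
open import Function using (_∘_; id)
open import Function.Bundles using (_⇔_; mk⇔)
open import Relation.Nullary using (yes; no)
open import Relation.Binary.PropositionalEquality
  using (_≡_; refl; sym; trans; cong; cong₂; subst; module ≡-Reasoning)

sumFin-cong : ∀ m {f g : Fin m → ℕ} → (∀ i → f i ≡ g i) → sumFin m f ≡ sumFin m g
sumFin-cong zero    f≗g = refl
sumFin-cong (suc m) f≗g = cong₂ _+_ (f≗g zero) (sumFin-cong m (f≗g ∘ suc))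

sumFin-+ : ∀ m (f g : Fin m → ℕ) → sumFin m (λ i → f i + g i) ≡ sumFin m f + sumFin m g
sumFin-+ zero    f g = refl
sumFin-+ (suc m) f g =
  trans (cong (f zero + g zero +_) (sumFin-+ m (f ∘ suc) (g ∘ suc)))
        (interchange +-commutativeSemigroup (f zero) (g zero) _ _)

term≤sumFin : ∀ m (f : Fin m → ℕ) i → f i ≤ sumFin m f
term≤sumFin (suc m) f zero    = m≤m+n _ _
term≤sumFin (suc m) f (suc i) = ≤-trans (term≤sumFin m (f ∘ suc) i) (m≤n+m _ _)

sumFin-positive : ∀ m (f : Fin m → ℕ) → 0 < sumFin m f → Σ (Fin m) λ i → 0 < f i
sumFin-positive (suc m) f pos with f zero in f₀≡
... | suc _ = zero , subst (0 <_) (sym f₀≡) z<s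
... | zero  = map suc id (sumFin-positive m (f ∘ suc) pos)

δ-refl : ∀ {n} (u : Fin n) → δ u u ≡ 1
δ-refl u with u ≟ u
... | yes _   = refl
... | no u≢u  = ⊥-elim (u≢u refl)

δ-positive⇒≡ : ∀ {n} (u v : Fin n) k → 0 < δ u v * k → u ≡ v
δ-positive⇒≡ u v k pos with u ≟ v
... | yes u≡v = u≡v
... | no  _   = ⊥-elim (n≮0 pos)

IsLoop⇒inc≡2 : (G : Graph) (e : Edge G) → IsLoop G e → Σ (Vertex G) λ u → inc G e u ≡ 2
IsLoop⇒inc≡2 G e isLoop with ends G e
... | loop u = u , cong (2 *_) (δ-refl u)

∈-true : {G : Graph} {M : Edge G → Bool} (e : Edge G) → M e ≡ true → [_∈_] {G} e M ≡ 1
∈-true e e∈M rewrite e∈M = refl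

loop∉semiPerfectMatching : {G : Graph} {M : Edge G → Bool} → IsSemiPerfectMatching G M →
  (e : Edge G) → IsLoop G e → M e ≡ false
loop∉semiPerfectMatching {G} {M} isSPM e isLoop with IsLoop⇒inc≡2 G e isLoop | M e in e∈M
... | _       | false = refl
... | u , inc≡2 | true  = ⊥-elim (n≮n 1 (begin
  2                         ≡⟨ sym (cong₂ _*_ (∈-true {G} {M} e e∈M) inc≡2) ⟩
  [_∈_] {G} e M * inc G e u ≤⟨ term≤sumFin (nE G) (λ e′ → [_∈_] {G} e′ M * inc G e′ u) e ⟩
  sumFin (nE G) _           ≡⟨ isSPM u ⟩
  1                         ∎))
  where open ≤-Reasoning

fibreDegree : (G H : Graph) → (Edge G → Edge H) → Edge H → Vertex G → ℕ
fibreDegree G H fE e′ v = sumFin (nE G) (λ e → δ (fE e) e′ * inc G e v)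

fibreDegree-positive⇒∈image : (G H : Graph) (fE : Edge G → Edge H) → ∀ e′ v →
  0 < fibreDegree G H fE e′ v → Σ (Edge G) λ e → fE e ≡ e′
fibreDegree-positive⇒∈image G H fE e′ v pos =
  let e , term>0 = sumFin-positive (nE G) (λ e → δ (fE e) e′ * inc G e v) pos
  in  e , δ-positive⇒≡ (fE e) e′ (inc G e v) term>0

pattern semiEdge = zero
pattern loopEdge = suc zero

isSemiEdge : Edge F11 → Bool
isSemiEdge semiEdge = true
isSemiEdge loopEdge = false

IsSemi⇒isSemiEdge : (e′ : Edge F11) → IsSemi F11 e′ → isSemiEdge e′ ≡ true
IsSemi⇒isSemiEdge semiEdge _ = refl

F11-semiOrLoop : (e′ : Edge F11) → IsSemi F11 e′ ⊎ IsLoop F11 e′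
F11-semiOrLoop semiEdge = inj₁ tt
F11-semiOrLoop loopEdge = inj₂ tt

F11-incident : (e′ : Edge F11) (x : Vertex F11) → 0 < inc F11 e′ x
F11-incident semiEdge zero = z<s
F11-incident loopEdge zero = z<s

inc-F11-semiEdge : (x : Vertex F11) → inc F11 semiEdge x ≡ 1
inc-F11-semiEdge zero = refl

δ-semiEdge+δ-loopEdge : (e′ : Edge F11) → δ e′ semiEdge + δ e′ loopEdge ≡ 1
δ-semiEdge+δ-loopEdge semiEdge = refl
δ-semiEdge+δ-loopEdge loopEdge = refl

fibreDegree-semiEdge+loopEdge : (G : Graph) (fE : Edge G → Edge F11) (v : Vertex G) →
  fibreDegree G F11 fE semiEdge v + fibreDegree G F11 fE loopEdge v ≡ deg G v
fibreDegree-semiEdge+loopEdge G fE v =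
  trans (sym (sumFin-+ (nE G) (darts-to semiEdge) (darts-to loopEdge)))
        (sumFin-cong (nE G) darts-of)
  where
  darts-to : Edge F11 → Edge G → ℕ
  darts-to e′ e = δ (fE e) e′ * inc G e v

  darts-of : ∀ e → darts-to semiEdge e + darts-to loopEdge e ≡ inc G e v
  darts-of e = begin
    darts-to semiEdge e + darts-to loopEdge e
      ≡⟨ sym (*-distribʳ-+ (inc G e v) (δ (fE e) semiEdge) _) ⟩
    (δ (fE e) semiEdge + δ (fE e) loopEdge) * inc G e v
      ≡⟨ cong (_* inc G e v) (δ-semiEdge+δ-loopEdge (fE e)) ⟩
    1 * inc G e v
      ≡⟨ *-identityˡ (inc G e v) ⟩
    inc G e v ∎
    where open ≡-Reasoning

∈-preimage-semiEdge : (G : Graph) (fE : Edge G → Edge F11) (e : Edge G) →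
  [_∈_] {G} e (isSemiEdge ∘ fE) ≡ δ (fE e) semiEdge
∈-preimage-semiEdge G fE e with fE e
... | semiEdge = refl
... | loopEdge = refl

preimage-semiEdge-isSemiPerfectMatching :
  {G : Graph} {fV : Vertex G → Vertex F11} {fE : Edge G → Edge F11} →
  ProjectionBase G F11 fV fE → IsSemiPerfectMatching G (isSemiEdge ∘ fE)
preimage-semiEdge-isSemiPerfectMatching {G} {fV} {fE} base v = begin
  sumFin (nE G) (λ e → [_∈_] {G} e (isSemiEdge ∘ fE) * inc G e v)
    ≡⟨ sumFin-cong (nE G) (λ e → cong (_* inc G e v) (∈-preimage-semiEdge G fE e)) ⟩
  fibreDegree G F11 fE semiEdge v
    ≡⟨ ProjectionBase.localBij base v semiEdge ⟩
  inc F11 semiEdge (fV v)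
    ≡⟨ inc-F11-semiEdge (fV v) ⟩
  1 ∎
  where open ≡-Reasoning

module SemiPerfectMatchingProjection (G : Graph) (v₀ : Vertex G) (cubic : Cubic G)
                                     (M : Edge G → Bool) (isSPM : IsSemiPerfectMatching G M) where

  fV : Vertex G → Vertex F11
  fV _ = zero

  fE : Edge G → Edge F11
  fE e = if M e then semiEdge else loopEdge

  fE-∈ : (e : Edge G) → M e ≡ true → fE e ≡ semiEdge
  fE-∈ e e∈M rewrite e∈M = refl

  fE-∉ : (e : Edge G) → M e ≡ false → fE e ≡ loopEdge
  fE-∉ e e∉M rewrite e∉M = refl

  δ-fE-semiEdge : (e : Edge G) → δ (fE e) semiEdge ≡ [_∈_] {G} e M
  δ-fE-semiEdge e with M e
  ... | true  = refl
  ... | false = refl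

  fibreDegree-semiEdge : (v : Vertex G) → fibreDegree G F11 fE semiEdge v ≡ 1
  fibreDegree-semiEdge v =
    trans (sumFin-cong (nE G) (λ e → cong (_* inc G e v) (δ-fE-semiEdge e))) (isSPM v)

  fibreDegree-loopEdge : (v : Vertex G) → fibreDegree G F11 fE loopEdge v ≡ 2
  fibreDegree-loopEdge v = suc-injective (begin
    1 + fibreDegree G F11 fE loopEdge v
      ≡⟨ cong (_+ fibreDegree G F11 fE loopEdge v) (sym (fibreDegree-semiEdge v)) ⟩
    fibreDegree G F11 fE semiEdge v + fibreDegree G F11 fE loopEdge v
      ≡⟨ fibreDegree-semiEdge+loopEdge G fE v ⟩
    deg G v
      ≡⟨ cubic v ⟩
    3 ∎)
    where open ≡-Reasoning

  localBij : (v : Vertex G) (e′ : Edge F11) → fibreDegree G F11 fE e′ v ≡ inc F11 e′ (fV v)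
  localBij v semiEdge = fibreDegree-semiEdge v
  localBij v loopEdge = fibreDegree-loopEdge v

  surjE : Surjective fE
  surjE e′ = fibreDegree-positive⇒∈image G F11 fE e′ v₀
    (subst (0 <_) (sym (localBij v₀ e′)) (F11-incident e′ (fV v₀)))

  base : ProjectionBase G F11 fV fE
  base = record
    { surjV    = λ { zero → v₀ , refl }
    ; surjE    = surjE
    ; degPres  = λ v → sym (cubic v)
    ; incPres  = λ e v _ → F11-incident (fE e) (fV v)
    ; localBij = localBij
    }

  loop→loop : (e : Edge G) → IsLoop G e → IsLoop F11 (fE e)
  loop→loop e isLoop =
    subst (IsLoop F11) (sym (fE-∉ e (loop∉semiPerfectMatching {G} {M} isSPM e isLoop))) tt

  semiCovering : SemiCovers G F11
  semiCovering = record
    { fV = fV ; fE = fE ; base = base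
    ; semi→semiOrLoop = λ e _ → F11-semiOrLoop (fE e)
    ; loop→loop = loop→loop
    }

  covering : ((e : Edge G) → IsSemi G e → M e ≡ true) → Covers G F11
  covering semi∈M = record
    { fV = fV ; fE = fE ; base = base
    ; semi→semi = λ e isSemi → subst (IsSemi F11) (sym (fE-∈ e (semi∈M e isSemi))) tt
    ; loop→loop = loop→loop
    }

semiCovering⇒semiPerfectMatching : (G : Graph) → SemiCovers G F11 → HasSemiPerfectMatching G
semiCovering⇒semiPerfectMatching G c =
  isSemiEdge ∘ fE , preimage-semiEdge-isSemiPerfectMatching base
  where open SemiCoveringProjection c

covering⇒semiPerfectMatchingWithAllSemiEdges : (G : Graph) → Covers G F11 →
  HasSemiPerfectMatchingWithAllSemiEdges G
covering⇒semiPerfectMatchingWithAllSemiEdges G c =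
  isSemiEdge ∘ fE , preimage-semiEdge-isSemiPerfectMatching base ,
  λ e isSemi → IsSemi⇒isSemiEdge (fE e) (semi→semi e isSemi)
  where open CoveringProjection c

proposition10 : (G : Graph) → 0 < nV G → Cubic G →
    (SemiCovers G F11 ⇔ HasSemiPerfectMatching G) ×
    (Covers G F11 ⇔ HasSemiPerfectMatchingWithAllSemiEdges G)
proposition10 G nonempty cubic =
  mk⇔ (semiCovering⇒semiPerfectMatching G)
      (λ (M , isSPM) → SemiPerfectMatchingProjection.semiCovering G v₀ cubic M isSPM) ,
  mk⇔ (covering⇒semiPerfectMatchingWithAllSemiEdges G)
      (λ (M , isSPM , semi∈M) → SemiPerfectMatchingProjection.covering G v₀ cubic M isSPM semi∈M)
  where
  v₀ : Vertex G
  v₀ = fromℕ< nonempty
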